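{- The upper asymptotic density of the set of matchable positive integers is at most $\alpha=\prod_{p\ \mathrm{prime}}\left(1-p^{ -p}\right)$.
   Context: For a positive integer $n$, let $D(n)$ be its set of positive divisors and $\tau(n)=|D(n)|$. A coprime matching between two finite sets of integers of the same cardinality is a bijection $\psi$ between them such that $\gcd(x,\psi(x))=1$ for every $x$ in the domain. A positive integer $n$ is called matchable if there is a coprime matching between $\{1,2,\dots,\tau(n)\}$ and $D(n)$. -}

module Defs where

open import Data.Nat using (ℕ; zero; suc; _^_; _∸_; _≤_; _<_)
open import Data.Nat.Divisibility using (_∣_; _∣?_)
open import Data.Nat.Coprimality using (Coprime)
open import Data.Nat.Primality using (prime?)
open import Data.Nat.Properties using (m^n≢0)
open import Data.Fin using (Fin; toℕ)
open import Data.List using (List; length; filter; map; upTo; foldr)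
open import Data.Product using (Σ; ∃; _×_)
open import Data.Integer using (+_)
open import Data.Rational using (ℚ; _/_; _*_; 1ℚ)
open import Function.Definitions using (Injective)
open import Relation.Binary.PropositionalEquality using (_≡_)

divisorList : ℕ → List ℕ
divisorList n = filter (_∣? n) (map suc (upTo n))

τ : ℕ → ℕ
τ n = length (divisorList n)

-- A coprime matching between {1,…,τ(n)} and D(n): a bijection
-- ψ : {1,…,τ(n)} → D(n) (index i : Fin (τ n) stands for the integer i+1)
-- with gcd(i+1, ψ(i+1)) = 1.
record CoprimeMatching (n : ℕ) : Set where
  field
    ψ         : Fin (τ n) → ℕ
    into      : ∀ i → ψ i ∣ n
    injective : Injective _≡_ _≡_ ψ
    onto      : ∀ d → 0 < d → d ∣ n → ∃ λ i → ψ i ≡ d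
    coprime   : ∀ i → Coprime (suc (toℕ i)) (ψ i)

Matchable : ℕ → Set
Matchable n = CoprimeMatching n

factor : ℕ → ℚ
factor zero = 1ℚ
factor (suc m) = + (suc m ^ suc m ∸ 1) / (suc m ^ suc m)
  where instance _ = m^n≢0 (suc m) (suc m)

partialα : ℕ → ℚ
partialα K = foldr (λ p acc → factor p * acc) 1ℚ (filter prime? (upTo (suc K)))

ℕ→ℚ : ℕ → ℚ
ℕ→ℚ n = + n / 1

{-# OPTIONS --safe #-}
module Submission where

-- Let t be the number of divisors of n prime to p. If p^p ∣ n, the divisors p^j e (j ≤ p, p ∤ e)
-- show τ(n) ≥ (p + 1) t; if moreover t ≥ p, the indices p, 2p, …, (t + 1) p all lie in
-- {1, …, τ(n)}, and a coprime matching sends them to t + 1 distinct divisors prime to p, which is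
-- absurd. So a matchable n either has no divisor p^p with p ≤ K prime, or fewer than K + 2
-- divisors prime to K!. The first kind has density exactly ∏_{p ≤ K} (1 − p^{−p}) in each period
-- ∏ p^p. For the second kind we build moduli L₀, …, L_K, pairwise coprime and coprime
-- to K!, with φ(L_i)/L_i ≤ 1/(2w): if n shared a factor with every L_i, then 1 and the
-- gcd(n, L_i) would be K + 2 distinct divisors prime to K!, so n is coprime to some L_i, which
-- happens for at most a proportion (K + 1)/(2w) of all n. Such a modulus is
-- L = ∏_{j < 2^G} (1 + jC): it is coprime to C, and since each 1 + jC divides L,
-- φ(L) ≤ (1 + jC) · #{x ≤ L : gcd(x, L) = 1 + jC}; summing over j against the harmonic series
-- gives G · φ(L) ≤ 2 C L. Taking w = (K + 1) q with q the denominator of ε finishes the proof.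

open import Defs
open import Data.Nat using (ℕ; _≤_; _<_)
open import Data.List using (List; length)
open import Data.List.Relation.Unary.All using (All)
open import Data.List.Relation.Unary.Unique.Propositional using (Unique)
open import Data.Product using (Σ; _×_)

-- The operators of ℕ are opened only inside this block: the theorem below uses those of ℚ.
module _ where
  open import Level using (Level)
  open import Data.Nat
  open import Data.Nat.Properties
  open import Data.Nat.Tactic.RingSolver using (solve-∀)
  open import Data.Nat.DivMod using (_/_; _%_; m≡m%n+[m/n]*n; m%n<n; m/n*n≤m)
  open import Data.Nat.Divisibility
  open import Data.Nat.GCD using (gcd; gcd[m,n]∣m; gcd[m,n]∣n; c*gcd[m,n]≡gcd[cm,cn])
  open import Data.Nat.Coprimality
    using (Coprime; coprime?; coprime-divisor; coprime-+; 1-coprimeTo; gcd≡1⇒coprime; coprime⇒gcd≡1)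
    renaming (sym to Coprime-sym)
  open import Data.Nat.Primality using (Prime; prime?; prime⇒irreducible; prime⇒nonZero; ¬prime[1])
  open import Data.Nat.ListAction using (product)
  open import Data.Nat.ListAction.Properties using (∈⇒∣product; product≢0)
  open import Data.List
    using (List; []; _∷_; _++_; length; map; filter; upTo; applyUpTo; applyDownFrom; cartesianProduct; allFin)
  open import Data.Fin using (Fin; toℕ; fromℕ<)
  open import Data.Fin.Properties using (toℕ<n; toℕ-fromℕ<; toℕ-injective)
  open import Data.List.Membership.Propositional using (_∈_)
  open import Data.List.Membership.Propositional.Properties
    using ( ∈-∃++; ∈-++⁻; ∈-++⁺ˡ; ∈-++⁺ʳ; ∈-map⁺; ∈-map⁻; ∈-filter⁺; ∈-filter⁻; ∈-upTo⁺; ∈-upTo⁻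
          ; ∈-applyUpTo⁺; ∈-applyDownFrom⁺; ∈-cartesianProduct⁻)
  open import Data.List.Properties using (length-++; length-map; length-upTo; length-applyUpTo; length-tabulate)
  open import Data.List.Relation.Binary.Subset.Propositional using (_⊆_)
  open import Data.List.Relation.Unary.All as All using (All)
  import Data.List.Relation.Unary.All.Properties as AllP
  open import Data.List.Relation.Unary.Any using (here; there)
  open import Data.List.Relation.Unary.Unique.Propositional using (Unique)
  import Data.List.Relation.Unary.Unique.Propositional.Properties as UniqueP
  open import Data.List.Relation.Unary.AllPairs using (AllPairs; []; _∷_)
  import Data.List.Relation.Unary.AllPairs.Properties as AllPairsP
  open import Data.Product using (∃; _×_; _,_; proj₂; uncurry)
  import Data.Product as Product
  open import Data.Sum using (_⊎_; inj₁; inj₂)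
  open import Data.Empty using (⊥-elim)
  open import Function using (_∘_; id)
  open import Relation.Nullary using (Dec; yes; no; ¬_; ¬?; _×-dec_; _⊎-dec_; contradiction)
  open import Relation.Unary as U using (Pred; Decidable; _∪_; _≐_)
  open import Relation.Unary.Properties using (_∪?_; _∩?_; ∁?)
  open import Relation.Binary.PropositionalEquality
  open import Algebra.Properties.CommutativeSemigroup +-commutativeSemigroup using (interchange)

  private
    variable
      ℓ ℓ₁ ℓ₂ : Level
      A B : Set ℓ

  ∑ : ℕ → (ℕ → ℕ) → ℕ
  ∑ zero    f = 0
  ∑ (suc J) f = ∑ J f + f J

  syntax ∑ J (λ j → e) = ∑[ j < J ] e

  module _ {f g : ℕ → ℕ} where

    ∑-cong : ∀ J → (∀ {j} → j < J → f j ≡ g j) → ∑ J f ≡ ∑ J g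
    ∑-cong zero    eq = refl
    ∑-cong (suc J) eq = cong₂ _+_ (∑-cong J (eq ∘ m≤n⇒m≤1+n)) (eq ≤-refl)

    ∑-mono-≤ : ∀ J → (∀ {j} → j < J → f j ≤ g j) → ∑ J f ≤ ∑ J g
    ∑-mono-≤ zero    le = z≤n
    ∑-mono-≤ (suc J) le = +-mono-≤ (∑-mono-≤ J (le ∘ m≤n⇒m≤1+n)) (le ≤-refl)

    ∑-distrib-+ : ∀ J → ∑[ j < J ] (f j + g j) ≡ ∑ J f + ∑ J g
    ∑-distrib-+ zero    = refl
    ∑-distrib-+ (suc J) = trans (cong (_+ (f J + g J)) (∑-distrib-+ J))
                                (interchange (∑ J f) (∑ J g) (f J) (g J))

  ∑-distribˡ-* : ∀ c (f : ℕ → ℕ) J → ∑[ j < J ] (c * f j) ≡ c * ∑ J f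
  ∑-distribˡ-* c f zero    = sym (*-zeroʳ c)
  ∑-distribˡ-* c f (suc J) = trans (cong (_+ c * f J) (∑-distribˡ-* c f J))
                                   (sym (*-distribˡ-+ c (∑ J f) (f J)))

  ∑-const : ∀ c J → ∑[ j < J ] c ≡ J * c
  ∑-const c zero    = refl
  ∑-const c (suc J) = trans (cong (_+ c) (∑-const c J)) (+-comm (J * c) c)

  ∑-split : ∀ (f : ℕ → ℕ) a b → ∑ (a + b) f ≡ ∑ a f + ∑[ k < b ] f (a + k)
  ∑-split f a zero    = trans (cong (λ n → ∑ n f) (+-identityʳ a)) (sym (+-identityʳ _))
  ∑-split f a (suc b) = begin
    ∑ (a + suc b) f                              ≡⟨ cong (λ n → ∑ n f) (+-suc a b) ⟩
    ∑ (a + b) f + f (a + b)                      ≡⟨ cong (_+ f (a + b)) (∑-split f a b) ⟩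
    ∑ a f + ∑[ k < b ] f (a + k) + f (a + b)     ≡⟨ +-assoc (∑ a f) _ _ ⟩
    ∑ a f + (∑[ k < b ] f (a + k) + f (a + b))   ∎
    where open ≡-Reasoning

  indicator : Dec A → ℕ
  indicator (yes _) = 1
  indicator (no _)  = 0

  indicator≤1 : (x? : Dec A) → indicator x? ≤ 1
  indicator≤1 (yes _) = ≤-refl
  indicator≤1 (no _)  = z≤n

  indicator-mono : (A → B) → (x? : Dec A) (y? : Dec B) → indicator x? ≤ indicator y?
  indicator-mono f (yes x) (yes _) = ≤-refl
  indicator-mono f (yes x) (no ¬y) = contradiction (f x) ¬y
  indicator-mono f (no _)  _       = z≤n

  indicator-cong : (A → B) → (B → A) → (x? : Dec A) (y? : Dec B) → indicator x? ≡ indicator y?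
  indicator-cong f g x? y? = ≤-antisym (indicator-mono f x? y?) (indicator-mono g y? x?)

  indicator-⊎-≤ : (x? : Dec A) (y? : Dec B) → indicator (x? ⊎-dec y?) ≤ indicator x? + indicator y?
  indicator-⊎-≤ (yes _) _       = s≤s z≤n
  indicator-⊎-≤ (no _)  (yes _) = ≤-refl
  indicator-⊎-≤ (no _)  (no _)  = z≤n

  indicator-⊎-disjoint : (A → ¬ B) → (x? : Dec A) (y? : Dec B) →
                         indicator (x? ⊎-dec y?) ≡ indicator x? + indicator y?
  indicator-⊎-disjoint disj (yes x) (yes y) = contradiction y (disj x)
  indicator-⊎-disjoint disj (yes _) (no _)  = refl
  indicator-⊎-disjoint disj (no _)  (yes _) = refl
  indicator-⊎-disjoint disj (no _)  (no _)  = refl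

  indicator-split : (x? : Dec A) (y? : Dec B) →
                    indicator x? ≡ indicator (x? ×-dec y?) + indicator (x? ×-dec ¬? y?)
  indicator-split (yes _) (yes _) = refl
  indicator-split (yes _) (no _)  = refl
  indicator-split (no _)  _       = refl

  count : {P : Pred ℕ ℓ} → Decidable P → ℕ → ℕ
  count P? N = ∑[ x < N ] indicator (P? (suc x))

  module _ {P : Pred ℕ ℓ₁} {Q : Pred ℕ ℓ₂} (P? : Decidable P) (Q? : Decidable Q) where

    count-mono : P U.⊆ Q → ∀ N → count P? N ≤ count Q? N
    count-mono P⊆Q N = ∑-mono-≤ N (λ _ → indicator-mono P⊆Q (P? _) (Q? _))

    count-cong : P ≐ Q → ∀ N → count P? N ≡ count Q? N
    count-cong (P⊆Q , Q⊆P) N = ∑-cong N (λ _ → indicator-cong P⊆Q Q⊆P (P? _) (Q? _))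

    count-∪-≤ : ∀ N → count (P? ∪? Q?) N ≤ count P? N + count Q? N
    count-∪-≤ N = ≤-trans (∑-mono-≤ N (λ _ → indicator-⊎-≤ (P? _) (Q? _)))
                          (≤-reflexive (∑-distrib-+ N))

    count-∪-disjoint : (∀ {x} → P x → ¬ Q x) → ∀ N → count (P? ∪? Q?) N ≡ count P? N + count Q? N
    count-∪-disjoint disj N = trans (∑-cong N (λ _ → indicator-⊎-disjoint disj (P? _) (Q? _)))
                                    (∑-distrib-+ N)

    count-split : ∀ N → count P? N ≡ count (P? ∩? Q?) N + count (P? ∩? ∁? Q?) N
    count-split N = trans (∑-cong N (λ _ → indicator-split (P? _) (Q? _))) (∑-distrib-+ N)

  module _ {P : Pred ℕ ℓ} (P? : Decidable P) where

    count≤ : ∀ N → count P? N ≤ N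
    count≤ N = begin
      count P? N     ≤⟨ ∑-mono-≤ N (λ _ → indicator≤1 (P? _)) ⟩
      ∑[ x < N ] 1   ≡⟨ ∑-const 1 N ⟩
      N * 1          ≡⟨ *-identityʳ N ⟩
      N              ∎
      where open ≤-Reasoning

    count-none : ∀ M → (∀ {x} → 0 < x → x ≤ M → ¬ P x) → count P? M ≡ 0
    count-none M none = n≤0⇒n≡0 (≤-trans (∑-mono-≤ M absent) (≤-reflexive (trans (∑-const 0 M) (*-zeroʳ M))))
      where
      absent : ∀ {x} → x < M → indicator (P? (suc x)) ≤ 0
      absent {x} x<M with P? (suc x)
      ... | yes p = contradiction p (none (s≤s z≤n) x<M)
      ... | no _  = z≤n

    count-shift : ∀ d m → count P? (d + m) ≡ count P? d + count (λ x → P? (d + x)) m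
    count-shift d m = trans (∑-split _ d m)
      (cong (count P? d +_) (∑-cong m (λ {k} _ → cong (indicator ∘ P?) (sym (+-suc d k)))))

    count-monoʳ-≤ : ∀ {N M} → N ≤ M → count P? N ≤ count P? M
    count-monoʳ-≤ {N} {M} N≤M = begin
      count P? N                                        ≤⟨ m≤m+n _ _ ⟩
      count P? N + count (λ x → P? (N + x)) (M ∸ N)     ≡⟨ count-shift N (M ∸ N) ⟨
      count P? (N + (M ∸ N))                            ≡⟨ cong (count P?) (m+[n∸m]≡n N≤M) ⟩
      count P? M                                        ∎
      where open ≤-Reasoning

  module _ {P : ℕ → Pred ℕ ℓ} (P? : ∀ i → Decidable (P i)) where

    ∃< : ℕ → Pred ℕ ℓ
    ∃< m x = ∃ λ i → i < m × P i x

    ∃<? : ∀ m → Decidable (∃< m)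
    ∃<? m x = anyUpTo? (λ i → P? i x) m

    private
      ∃<-suc : ∀ m → ∃< (suc m) ≐ (∃< m ∪ P m)
      ∃<-suc m = split , join
        where
        split : ∃< (suc m) U.⊆ (∃< m ∪ P m)
        split (i , i<1+m , p) with m≤n⇒m<n∨m≡n (≤-pred i<1+m)
        ... | inj₁ i<m  = inj₁ (i , i<m , p)
        ... | inj₂ refl = inj₂ p
        join : (∃< m ∪ P m) U.⊆ ∃< (suc m)
        join (inj₁ (i , i<m , p)) = i , m≤n⇒m≤1+n i<m , p
        join (inj₂ p)             = m , ≤-refl , p

    count-∃<-≤ : ∀ m N → count (∃<? m) N ≤ ∑[ i < m ] count (P? i) N
    count-∃<-≤ zero    N = ≤-reflexive (count-none (∃<? 0) N (λ { _ _ (_ , () , _) }))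
    count-∃<-≤ (suc m) N = begin
      count (∃<? (suc m)) N                      ≡⟨ count-cong (∃<? (suc m)) (∃<? m ∪? P? m) (∃<-suc m) N ⟩
      count (∃<? m ∪? P? m) N                    ≤⟨ count-∪-≤ (∃<? m) (P? m) N ⟩
      count (∃<? m) N + count (P? m) N           ≤⟨ +-monoˡ-≤ _ (count-∃<-≤ m N) ⟩
      ∑[ i < m ] count (P? i) N + count (P? m) N ∎
      where open ≤-Reasoning

    count-∃<-disjoint : (∀ {i j x} → P i x → P j x → i ≡ j) →
                        ∀ m N → count (∃<? m) N ≡ ∑[ i < m ] count (P? i) N
    count-∃<-disjoint disj zero    N = count-none (∃<? 0) N (λ { _ _ (_ , () , _) })
    count-∃<-disjoint disj (suc m) N = begin
      count (∃<? (suc m)) N                      ≡⟨ count-cong (∃<? (suc m)) (∃<? m ∪? P? m) (∃<-suc m) N ⟩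
      count (∃<? m ∪? P? m) N                    ≡⟨ count-∪-disjoint (∃<? m) (P? m) below N ⟩
      count (∃<? m) N + count (P? m) N           ≡⟨ cong (_+ count (P? m) N) (count-∃<-disjoint disj m N) ⟩
      ∑[ i < m ] count (P? i) N + count (P? m) N ∎
      where
      open ≡-Reasoning
      below : ∀ {x} → ∃< m x → ¬ P m x
      below (i , i<m , p) q = <⇒≢ i<m (disj p q)

  Periodic : ℕ → Pred ℕ ℓ → Set ℓ
  Periodic d P = (λ x → P (d + x)) ≐ P

  module _ {P : Pred ℕ ℓ} (P? : Decidable P) where

    count-periodic : ∀ {d} → Periodic d P → ∀ t → count P? (t * d) ≡ t * count P? d
    count-periodic         per zero    = refl
    count-periodic {d = d} per (suc t) = begin
      count P? (d + t * d)                                ≡⟨ count-shift P? d (t * d) ⟩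
      count P? d + count (λ x → P? (d + x)) (t * d)       ≡⟨ cong (count P? d +_) shifted ⟩
      count P? d + count P? (t * d)                       ≡⟨ cong (count P? d +_) (count-periodic per t) ⟩
      count P? d + t * count P? d                         ∎
      where
      open ≡-Reasoning
      shifted : count (λ x → P? (d + x)) (t * d) ≡ count P? (t * d)
      shifted = count-cong (λ x → P? (d + x)) P? per (t * d)

    count-period-≤ : ∀ {d} .{{_ : NonZero d}} → Periodic d P → ∀ N →
                     d * count P? N ≤ (N + d) * count P? d
    count-period-≤ {d} per N = begin
      d * count P? N             ≤⟨ *-monoʳ-≤ d (count-monoʳ-≤ P? N≤t*d) ⟩
      d * count P? (t * d)       ≡⟨ cong (d *_) (count-periodic per t) ⟩
      d * (t * count P? d)       ≡⟨ *-assoc d t _ ⟨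
      d * t * count P? d         ≤⟨ *-monoˡ-≤ (count P? d) d*t≤N+d ⟩
      (N + d) * count P? d       ∎
      where
      open ≤-Reasoning
      t : ℕ
      t = suc (N / d)
      N≤t*d : N ≤ t * d
      N≤t*d = begin
        N                      ≡⟨ m≡m%n+[m/n]*n N d ⟩
        N % d + N / d * d      ≤⟨ +-monoˡ-≤ (N / d * d) (<⇒≤ (m%n<n N d)) ⟩
        t * d                  ∎
      d*t≤N+d : d * t ≤ N + d
      d*t≤N+d = begin
        d * t                  ≡⟨ *-comm d t ⟩
        d + N / d * d          ≤⟨ +-monoʳ-≤ d (m/n*n≤m N d) ⟩
        d + N                  ≡⟨ +-comm d N ⟩
        N + d                  ∎

    count-multiples : ∀ r .{{_ : NonZero r}} → P U.⊆ (r ∣_) → ∀ N →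
                      count P? (r * N) ≡ count (λ y → P? (r * y)) N
    count-multiples r P⊆r∣ zero    = cong (count P?) (*-zeroʳ r)
    count-multiples r@(suc r-1) P⊆r∣ (suc N) = begin
      count P? (r * suc N)                                     ≡⟨ cong (count P?) r*[1+N] ⟩
      count P? (r * N + r)                                     ≡⟨ count-shift P? (r * N) r ⟩
      count P? (r * N) + count (λ x → P? (r * N + x)) r
                                                               ≡⟨ cong₂ _+_ (count-multiples r P⊆r∣ N) last-block ⟩
      count (λ y → P? (r * y)) N + indicator (P? (r * suc N))  ∎
      where
      open ≡-Reasoning
      r*[1+N] : r * suc N ≡ r * N + r
      r*[1+N] = trans (*-suc r N) (+-comm r (r * N))
      no-multiple : ∀ {x} → 0 < x → x ≤ r-1 → ¬ P (r * N + x)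
      no-multiple 0<x x≤r-1 p =
        <⇒≱ (s≤s x≤r-1) (∣⇒≤ {{>-nonZero 0<x}} (∣m+n∣m⇒∣n (P⊆r∣ p) (m∣m*n N)))
      last-block : count (λ x → P? (r * N + x)) r ≡ indicator (P? (r * suc N))
      last-block = cong₂ _+_ (count-none (λ x → P? (r * N + x)) r-1 no-multiple)
                             (cong (indicator ∘ P?) (sym r*[1+N]))

  Unique⇒length≤ : {xs ys : List A} → Unique xs → xs ⊆ ys → length xs ≤ length ys
  Unique⇒length≤ {xs = []}     _              _     = z≤n
  Unique⇒length≤ {xs = x ∷ xs} (x∉xs ∷ !xs) xs⊆ys with ∈-∃++ (xs⊆ys (here refl))
  ... | ys₁ , ys₂ , refl = begin
    suc (length xs)               ≤⟨ s≤s (Unique⇒length≤ !xs xs⊆ys₁++ys₂) ⟩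
    suc (length (ys₁ ++ ys₂))     ≡⟨ cong suc (length-++ ys₁) ⟩
    suc (length ys₁ + length ys₂) ≡⟨ +-suc (length ys₁) (length ys₂) ⟨
    length ys₁ + length (x ∷ ys₂) ≡⟨ length-++ ys₁ ⟨
    length (ys₁ ++ x ∷ ys₂)       ∎
    where
    open ≤-Reasoning
    xs⊆ys₁++ys₂ : xs ⊆ ys₁ ++ ys₂
    xs⊆ys₁++ys₂ y∈xs with ∈-++⁻ ys₁ (xs⊆ys (there y∈xs))
    ... | inj₁ y∈ys₁         = ∈-++⁺ˡ y∈ys₁
    ... | inj₂ (here refl)   = contradiction refl (All.lookup x∉xs y∈xs)
    ... | inj₂ (there y∈ys₂) = ∈-++⁺ʳ ys₁ y∈ys₂

  module _ {P : Pred ℕ ℓ} (P? : Decidable P) where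

    length-filter-downFrom : ∀ N → length (filter P? (applyDownFrom suc N)) ≡ count P? N
    length-filter-downFrom zero = refl
    length-filter-downFrom (suc N) with P? (suc N)
    ... | yes _ = trans (cong suc (length-filter-downFrom N)) (+-comm 1 (count P? N))
    ... | no _  = trans (length-filter-downFrom N) (sym (+-identityʳ (count P? N)))

    length≤count : ∀ N {xs} → Unique xs → All (λ x → 1 ≤ x × x ≤ N × P x) xs → length xs ≤ count P? N
    length≤count N {xs} !xs bounds = begin
      length xs                                      ≤⟨ Unique⇒length≤ !xs xs⊆ ⟩
      length (filter P? (applyDownFrom suc N))       ≡⟨ length-filter-downFrom N ⟩
      count P? N                                     ∎
      where
      open ≤-Reasoning
      xs⊆ : xs ⊆ filter P? (applyDownFrom suc N)
      xs⊆ x∈xs with All.lookup bounds x∈xs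
      ... | s≤s z≤n , x≤N , p = ∈-filter⁺ P? (∈-applyDownFrom⁺ suc x≤N) p

  Unique-map⁺-on : ∀ {f : A → B} {xs} → (∀ {x y} → x ∈ xs → y ∈ xs → f x ≡ f y → x ≡ y) →
                   Unique xs → Unique (map f xs)
  Unique-map⁺-on f-inj []             = []
  Unique-map⁺-on f-inj (x∉xs ∷ !xs) =
    AllP.map⁺ (All.tabulate λ y∈xs fx≡fy → All.lookup x∉xs y∈xs (f-inj (here refl) (there y∈xs) fx≡fy))
    ∷ Unique-map⁺-on (λ x∈ y∈ → f-inj (there x∈) (there y∈)) !xs

  length-cartesianProduct : ∀ (xs : List A) (ys : List B) →
                            length (cartesianProduct xs ys) ≡ length xs * length ys
  length-cartesianProduct []       ys = refl
  length-cartesianProduct (x ∷ xs) ys = begin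
    length (map (x ,_) ys ++ cartesianProduct xs ys)         ≡⟨ length-++ (map (x ,_) ys) ⟩
    length (map (x ,_) ys) + length (cartesianProduct xs ys) ≡⟨ cong₂ _+_ (length-map (x ,_) ys)
                                                                          (length-cartesianProduct xs ys) ⟩
    length ys + length xs * length ys                        ∎
    where open ≡-Reasoning

  coprime-∣ˡ : ∀ {m n d} → Coprime m n → d ∣ m → Coprime d n
  coprime-∣ˡ c d∣m (i∣d , i∣n) = c (∣-trans i∣d d∣m , i∣n)

  coprime-∣ʳ : ∀ {m n d} → Coprime m n → d ∣ n → Coprime m d
  coprime-∣ʳ c d∣n = Coprime-sym (coprime-∣ˡ (Coprime-sym c) d∣n)

  coprime-*ˡ : ∀ {m n o} → Coprime m o → Coprime n o → Coprime (m * n) o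
  coprime-*ˡ {m} c₁ c₂ {i} (i∣mn , i∣o) = c₂ (coprime-divisor i⊥m i∣mn , i∣o)
    where
    i⊥m : Coprime i m
    i⊥m (j∣i , j∣m) = c₁ (j∣m , ∣-trans j∣i i∣o)

  coprime-^ˡ : ∀ {m n} k → Coprime m n → Coprime (m ^ k) n
  coprime-^ˡ {n = n} zero c = 1-coprimeTo n
  coprime-^ˡ (suc k)     c = coprime-*ˡ c (coprime-^ˡ k c)

  coprime-productˡ : ∀ {ms n} → All (λ m → Coprime m n) ms → Coprime (product ms) n
  coprime-productˡ {n = n} All.[] = 1-coprimeTo n
  coprime-productˡ (c All.∷ cs)   = coprime-*ˡ c (coprime-productˡ cs)

  coprime⇒*∣ : ∀ {m n o} → Coprime m n → m ∣ o → n ∣ o → m * n ∣ o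
  coprime⇒*∣ {m} {n} c (divides q refl) n∣qm = subst (m * n ∣_) (*-comm m q)
    (*-monoʳ-∣ m (coprime-divisor (Coprime-sym c) (subst (n ∣_) (*-comm q m) n∣qm)))

  prime∤⇒coprime : ∀ {p n} → Prime p → ¬ p ∣ n → Coprime p n
  prime∤⇒coprime pr p∤n (i∣p , i∣n) with prime⇒irreducible pr i∣p
  ... | inj₁ i≡1 = i≡1
  ... | inj₂ refl = contradiction i∣n p∤n

  prime∣coprime⇒∤ : ∀ {p m n} → Prime p → Coprime m n → p ∣ m → ¬ p ∣ n
  prime∣coprime⇒∤ pr c p∣m p∣n = ¬prime[1] (subst Prime (c (p∣m , p∣n)) pr)

  distinct-primes-coprime : ∀ {p q} → Prime p → Prime q → p ≢ q → Coprime p q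
  distinct-primes-coprime {p} pr qr p≢q = prime∤⇒coprime pr p∤q
    where
    p∤q : ¬ p ∣ _
    p∤q p∣q with prime⇒irreducible qr p∣q
    ... | inj₁ refl = ¬prime[1] pr
    ... | inj₂ p≡q  = p≢q p≡q

  coprime-^ : ∀ {m n} i j → Coprime m n → Coprime (m ^ i) (n ^ j)
  coprime-^ i j c = coprime-^ˡ i (Coprime-sym (coprime-^ˡ j (Coprime-sym c)))

  ^-monoʳ-∣ : ∀ p {j k} → j ≤ k → p ^ j ∣ p ^ k
  ^-monoʳ-∣ p {k = k} z≤n       = 1∣ (p ^ k)
  ^-monoʳ-∣ p         (s≤s j≤k) = *-monoʳ-∣ p (^-monoʳ-∣ p j≤k)

  p^i*m≡p^j*n⇒i≡j∧m≡n : ∀ {p} .{{_ : NonZero p}} {i j m n} → ¬ p ∣ m → ¬ p ∣ n →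
                        p ^ i * m ≡ p ^ j * n → i ≡ j × m ≡ n
  p^i*m≡p^j*n⇒i≡j∧m≡n {p} {zero} {zero} {m} {n} _ _ eq =
    refl , trans (sym (*-identityˡ m)) (trans eq (*-identityˡ n))
  p^i*m≡p^j*n⇒i≡j∧m≡n {p} {zero} {suc j} {m} {n} p∤m _ eq =
    contradiction (subst (p ∣_) (trans (sym eq) (*-identityˡ m)) (∣-trans (m∣m*n (p ^ j)) (m∣m*n n)))
                  p∤m
  p^i*m≡p^j*n⇒i≡j∧m≡n {p} {suc i} {zero} p∤m p∤n eq =
    Product.map sym sym (p^i*m≡p^j*n⇒i≡j∧m≡n p∤n p∤m (sym eq))
  p^i*m≡p^j*n⇒i≡j∧m≡n {p} {suc i} {suc j} {m} {n} p∤m p∤n eq =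
    Product.map₁ (cong suc) (p^i*m≡p^j*n⇒i≡j∧m≡n p∤m p∤n (*-cancelˡ-≡ _ _ p
      (trans (sym (*-assoc p (p ^ i) m)) (trans eq (*-assoc p (p ^ j) n)))))

  m≤n⇒m∣n! : ∀ {m n} .{{_ : NonZero m}} → m ≤ n → m ∣ n !
  m≤n⇒m∣n! {suc m} m≤n = ∣-trans (m∣m*n (m !)) (m≤n⇒m!∣n! m≤n)

  -- The sieve by prime powers

  NoneDivide : List ℕ → Pred ℕ _
  NoneDivide rs n = All (λ r → ¬ r ∣ n) rs

  noneDivide? : ∀ rs → Decidable (NoneDivide rs)
  noneDivide? rs n = All.all? (λ r → ¬? (r ∣? n)) rs

  noneDivide-periodic : ∀ rs → Periodic (product rs) (NoneDivide rs)
  noneDivide-periodic rs = shift⁻ , shift⁺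
    where
    shift⁻ : ∀ {x} → NoneDivide rs (product rs + x) → NoneDivide rs x
    shift⁻ nd = All.tabulate λ r∈rs r∣x → All.lookup nd r∈rs (∣m∣n⇒∣m+n (∈⇒∣product r∈rs) r∣x)
    shift⁺ : ∀ {x} → NoneDivide rs x → NoneDivide rs (product rs + x)
    shift⁺ nd = All.tabulate λ r∈rs r∣R+x → All.lookup nd r∈rs (∣m+n∣m⇒∣n r∣R+x (∈⇒∣product r∈rs))

  -- By periodicity, r c of the n ≤ r R avoid rs; exactly c of them are divisible by r, namely
  -- the r y with y ≤ R avoiding rs, as r is coprime to rs. Hence X = (r − 1) c.
  sieve : ∀ rs → All NonZero rs → AllPairs Coprime rs →
          count (noneDivide? rs) (product rs) ≡ product (map (_∸ 1) rs)
  sieve []       _                  _               = refl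
  sieve (r ∷ rs) (r≢0 All.∷ rs≢0) (r⊥rs ∷ rs-coprime) = begin
    X                          ≡⟨ m+n∸m≡n c X ⟨
    c + X ∸ c                  ≡⟨ cong₂ _∸_ c+X≡r*c (sym (*-identityˡ c)) ⟩
    r * c ∸ 1 * c              ≡⟨ *-distribʳ-∸ c r 1 ⟨
    (r ∸ 1) * c                ≡⟨ cong ((r ∸ 1) *_) (sieve rs rs≢0 rs-coprime) ⟩
    (r ∸ 1) * product (map (_∸ 1) rs) ∎
    where
    open ≡-Reasoning
    instance
      r-nonZero : NonZero r
      r-nonZero = r≢0
    R c X : ℕ
    R = product rs
    c = count (noneDivide? rs) R
    X = count (noneDivide? (r ∷ rs)) (r * R)
    r∣-part : count (noneDivide? rs ∩? (r ∣?_)) (r * R) ≡ c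
    r∣-part = trans (count-multiples (noneDivide? rs ∩? (r ∣?_)) r proj₂ R)
      (count-cong (λ y → (noneDivide? rs ∩? (r ∣?_)) (r * y)) (noneDivide? rs) (drop-r , add-r) R)
      where
      drop-r : ∀ {y} → NoneDivide rs (r * y) × r ∣ r * y → NoneDivide rs y
      drop-r (nd , _) = All.tabulate λ s∈rs s∣y → All.lookup nd s∈rs (∣-trans s∣y (n∣m*n r))
      add-r : ∀ {y} → NoneDivide rs y → NoneDivide rs (r * y) × r ∣ r * y
      add-r nd = All.tabulate (λ s∈rs s∣ry → All.lookup nd s∈rs
                   (coprime-divisor (Coprime-sym (All.lookup r⊥rs s∈rs)) s∣ry))
               , m∣m*n _
    r∤-part : count (noneDivide? rs ∩? ∁? (r ∣?_)) (r * R) ≡ X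
    r∤-part = count-cong (noneDivide? rs ∩? ∁? (r ∣?_)) (noneDivide? (r ∷ rs))
                ((λ (nd , r∤) → r∤ All.∷ nd) , λ r∤∷nd → All.tail r∤∷nd , All.head r∤∷nd) (r * R)
    c+X≡r*c : c + X ≡ r * c
    c+X≡r*c = begin
      c + X                                     ≡⟨ cong₂ _+_ r∣-part r∤-part ⟨
      count (noneDivide? rs ∩? (r ∣?_)) (r * R) + count (noneDivide? rs ∩? ∁? (r ∣?_)) (r * R)
                                                ≡⟨ count-split (noneDivide? rs) (r ∣?_) (r * R) ⟨
      count (noneDivide? rs) (r * R)            ≡⟨ count-periodic (noneDivide? rs) (noneDivide-periodic rs) r ⟩
      r * c                                     ∎

  ¬noneDivide⇒∃∣ : ∀ rs {n} → ¬ NoneDivide rs n → ∃ λ r → r ∈ rs × r ∣ n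
  ¬noneDivide⇒∃∣ []       ¬nd = contradiction All.[] ¬nd
  ¬noneDivide⇒∃∣ (r ∷ rs) {n} ¬nd with r ∣? n
  ... | yes r∣n = r , here refl , r∣n
  ... | no  r∤n with ¬noneDivide⇒∃∣ rs (¬nd ∘ (r∤n All.∷_))
  ...   | s , s∈rs , s∣n = s , there s∈rs , s∣n

  primesUpTo : ℕ → List ℕ
  primesUpTo K = filter prime? (upTo (suc K))

  primePowers : ℕ → List ℕ
  primePowers K = map (λ p → p ^ p) (primesUpTo K)

  module _ (K : ℕ) where

    primesUpTo-prime : All Prime (primesUpTo K)
    primesUpTo-prime = All.tabulate (proj₂ ∘ ∈-filter⁻ prime? {xs = upTo (suc K)})

    primePowers-nonZero : All NonZero (primePowers K)
    primePowers-nonZero = AllP.map⁺ (All.map (λ {p} pr → m^n≢0 p p {{prime⇒nonZero pr}}) primesUpTo-prime)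

    primePowers-coprime : AllPairs Coprime (primePowers K)
    primePowers-coprime =
      AllPairsP.map⁺ (pairwise primesUpTo-prime (UniqueP.filter⁺ prime? (UniqueP.upTo⁺ (suc K))))
      where
      pairwise : ∀ {ps} → All Prime ps → Unique ps → AllPairs (λ p q → Coprime (p ^ p) (q ^ q)) ps
      pairwise              All.[]         []           = []
      pairwise {ps = p ∷ _} (pr All.∷ prs) (p∉ps ∷ !ps) = All.tabulate (λ {q} q∈ps → coprime-^ {p} {q} p q
          (distinct-primes-coprime pr (All.lookup prs q∈ps) (All.lookup p∉ps q∈ps)))
        ∷ pairwise prs !ps

    count-sieved : ∀ N → product (primePowers K) * count (noneDivide? (primePowers K)) N
                         ≤ (N + product (primePowers K)) * product (map (_∸ 1) (primePowers K))
    count-sieved N = subst (λ c → product (primePowers K) * count (noneDivide? (primePowers K)) N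
                                    ≤ (N + product (primePowers K)) * c)
      (sieve (primePowers K) primePowers-nonZero primePowers-coprime)
      (count-period-≤ (noneDivide? (primePowers K)) {{product≢0 primePowers-nonZero}}
                      (noneDivide-periodic (primePowers K)) N)

  -- Totients of sparse moduli

  totient : ℕ → ℕ
  totient L = count (λ x → coprime? x L) L

  coprimeTo-periodic : ∀ L → Periodic L (λ x → Coprime x L)
  coprimeTo-periodic L = (λ c (i∣x , i∣L) → c (∣m∣n⇒∣m+n i∣L i∣x , i∣L)) , coprime-+

  totient≤*count-gcd≡ : ∀ {m L} .{{_ : NonZero m}} → m ∣ L →
                        totient L ≤ m * count (λ x → gcd x L ≟ m) L
  totient≤*count-gcd≡ {m} m∣L = subst (λ L → totient L ≤ m * count (λ x → gcd x L ≟ m) L)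
    (sym (m∣n⇒n≡m*quotient m∣L)) (bound (quotient m∣L))
    where
    bound : ∀ q → totient (m * q) ≤ m * count (λ x → gcd x (m * q) ≟ m) (m * q)
    bound q = begin
      totient (m * q)                              ≤⟨ count-mono (λ x → coprime? x (m * q)) (λ x → coprime? x q)
                                                        (λ c → coprime-∣ʳ c (n∣m*n m)) (m * q) ⟩
      count (λ x → coprime? x q) (m * q)           ≡⟨ count-periodic (λ x → coprime? x q) (coprimeTo-periodic q) m ⟩
      m * totient q                                ≡⟨ cong (m *_) gcd-fibre ⟨
      m * count (λ x → gcd x (m * q) ≟ m) (m * q)  ∎
      where
      open ≤-Reasoning
      gcd≡m⇒coprime : ∀ {y} → gcd (m * y) (m * q) ≡ m → Coprime y q
      gcd≡m⇒coprime {y} eq = gcd≡1⇒coprime (*-cancelˡ-≡ _ 1 m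
        (trans (c*gcd[m,n]≡gcd[cm,cn] m y q) (trans eq (sym (*-identityʳ m)))))
      coprime⇒gcd≡m : ∀ {y} → Coprime y q → gcd (m * y) (m * q) ≡ m
      coprime⇒gcd≡m {y} c = trans (sym (c*gcd[m,n]≡gcd[cm,cn] m y q))
        (trans (cong (m *_) (coprime⇒gcd≡1 c)) (*-identityʳ m))
      gcd-fibre : count (λ x → gcd x (m * q) ≟ m) (m * q) ≡ totient q
      gcd-fibre = trans
        (count-multiples (λ x → gcd x (m * q) ≟ m) m (λ {x} eq → subst (_∣ x) eq (gcd[m,n]∣m x (m * q))) q)
        (count-cong (λ y → gcd (m * y) (m * q) ≟ m) (λ y → coprime? y q) (gcd≡m⇒coprime , coprime⇒gcd≡m) q)

  count-fibres-≤ : ∀ (g h : ℕ → ℕ) → (∀ {i j} → h i ≡ h j → i ≡ j) →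
                   ∀ J N → ∑[ j < J ] count (λ x → g x ≟ h j) N ≤ N
  count-fibres-≤ g h h-injective J N = begin
    ∑[ j < J ] count (λ x → g x ≟ h j) N    ≡⟨ count-∃<-disjoint P? disjoint J N ⟨
    count (∃<? P? J) N                      ≤⟨ count≤ (∃<? P? J) N ⟩
    N                                       ∎
    where
    open ≤-Reasoning
    P? : ∀ j → Decidable (λ x → g x ≡ h j)
    P? j x = g x ≟ h j
    disjoint : ∀ {i j x} → g x ≡ h i → g x ≡ h j → i ≡ j
    disjoint eqᵢ eqⱼ = h-injective (trans (sym eqᵢ) eqⱼ)

  dyadic-harmonic : ∀ (f : ℕ → ℕ) A G → (∀ {j} → j < 2 ^ G → A ≤ suc j * f j) →
                    G * A ≤ 2 * ∑ (2 ^ G) f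
  dyadic-harmonic f A zero    _     = z≤n
  dyadic-harmonic f A (suc G) bound = begin
    A + G * A                                  ≤⟨ +-mono-≤ upper-half lower-half ⟩
    2 * ∑[ k < a ] f (a + k) + 2 * ∑ a f       ≡⟨ *-distribˡ-+ 2 (∑[ k < a ] f (a + k)) (∑ a f) ⟨
    2 * (∑[ k < a ] f (a + k) + ∑ a f)         ≡⟨ cong (2 *_) (trans (+-comm _ (∑ a f)) (sym (∑-split f a a))) ⟩
    2 * ∑ (a + a) f                            ≡⟨ cong (λ n → 2 * ∑ (a + n) f) (+-identityʳ a) ⟨
    2 * ∑ (2 ^ suc G) f                        ∎
    where
    open ≤-Reasoning
    a : ℕ
    a = 2 ^ G
    instance
      a-nonZero : NonZero a
      a-nonZero = m^n≢0 2 G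
    a+k<2^[1+G] : ∀ {k} → k < a → a + k < 2 ^ suc G
    a+k<2^[1+G] {k} k<a = subst (a + k <_) (cong (a +_) (sym (+-identityʳ a))) (+-monoʳ-< a k<a)
    lower-half : G * A ≤ 2 * ∑ a f
    lower-half = dyadic-harmonic f A G (λ j<a → bound (<-≤-trans j<a (m≤m+n a (a + 0))))
    upper-half : A ≤ 2 * ∑[ k < a ] f (a + k)
    upper-half = *-cancelˡ-≤ a (begin
      a * A                                    ≡⟨ ∑-const A a ⟨
      ∑[ k < a ] A                             ≤⟨ ∑-mono-≤ a (λ k<a → ≤-trans (bound (a+k<2^[1+G] k<a))
                                                                               (*-monoˡ-≤ _ (a+k<2^[1+G] k<a))) ⟩
      ∑[ k < a ] (2 ^ suc G * f (a + k))       ≡⟨ ∑-distribˡ-* (2 ^ suc G) (λ k → f (a + k)) a ⟩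
      2 * a * ∑[ k < a ] f (a + k)             ≡⟨ cong (_* ∑[ k < a ] f (a + k)) (*-comm 2 a) ⟩
      a * 2 * ∑[ k < a ] f (a + k)             ≡⟨ *-assoc a 2 _ ⟩
      a * (2 * ∑[ k < a ] f (a + k))           ∎)

  sparseModulus : ℕ → ℕ → ℕ
  sparseModulus C G = product (applyUpTo (λ j → suc (j * C)) (2 ^ G))

  module _ (C G : ℕ) where

    sparseModulus-nonZero : NonZero (sparseModulus C G)
    sparseModulus-nonZero = product≢0 (AllP.applyUpTo⁺₂ _ (2 ^ G) (λ _ → _))

    sparseModulus-coprime : Coprime (sparseModulus C G) C
    sparseModulus-coprime = coprime-productˡ (AllP.applyUpTo⁺₂ _ (2 ^ G) 1+jC⊥C)
      where
      1+jC⊥C : ∀ j → Coprime (suc (j * C)) C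
      1+jC⊥C j {i} (i∣1+jC , i∣C) =
        ∣1⇒≡1 (∣m+n∣m⇒∣n (subst (i ∣_) (+-comm 1 (j * C)) i∣1+jC) (∣-trans i∣C (n∣m*n j)))

    totient-sparseModulus : .{{NonZero C}} → G * totient (sparseModulus C G) ≤ 2 * (C * sparseModulus C G)
    totient-sparseModulus = begin
      G * totient L                  ≤⟨ dyadic-harmonic (λ j → C * c j) (totient L) G totient≤ ⟩
      2 * ∑[ j < 2 ^ G ] (C * c j)   ≡⟨ cong (2 *_) (∑-distribˡ-* C c (2 ^ G)) ⟩
      2 * (C * ∑ (2 ^ G) c)          ≤⟨ *-monoʳ-≤ 2 (*-monoʳ-≤ C fibres≤L) ⟩
      2 * (C * L)                    ∎
      where
      open ≤-Reasoning
      L : ℕ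
      L = sparseModulus C G
      h : ℕ → ℕ
      h j = suc (j * C)
      c : ℕ → ℕ
      c j = count (λ x → gcd x L ≟ h j) L
      h-injective : ∀ {i j} → h i ≡ h j → i ≡ j
      h-injective eq = *-cancelʳ-≡ _ _ C (suc-injective eq)
      fibres≤L : ∑ (2 ^ G) c ≤ L
      fibres≤L = count-fibres-≤ (λ x → gcd x L) h h-injective (2 ^ G) L
      totient≤ : ∀ {j} → j < 2 ^ G → totient L ≤ suc j * (C * c j)
      totient≤ {j} j<2^G = begin
        totient L                    ≤⟨ totient≤*count-gcd≡ (∈⇒∣product (∈-applyUpTo⁺ h j<2^G)) ⟩
        h j * c j                    ≤⟨ *-monoˡ-≤ (c j) (+-monoˡ-≤ (j * C) (>-nonZero⁻¹ C)) ⟩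
        suc j * C * c j              ≡⟨ *-assoc (suc j) C (c j) ⟩
        suc j * (C * c j)            ∎

  -- Divisors prime to p and coprime matchings

  module _ {n : ℕ} where

    ∈-divisorList⁺ : ∀ {d} .{{_ : NonZero n}} → d ∣ n → d ∈ divisorList n
    ∈-divisorList⁺ {zero}  0∣n = contradiction (0∣⇒≡0 0∣n) (≢-nonZero⁻¹ n)
    ∈-divisorList⁺ {suc d} d∣n = ∈-filter⁺ (_∣? n) (∈-map⁺ suc (∈-upTo⁺ (∣⇒≤ d∣n))) d∣n

    ∈-divisorList⁻ : ∀ {d} → d ∈ divisorList n → d ∣ n
    ∈-divisorList⁻ d∈ = proj₂ (∈-filter⁻ (_∣? n) {xs = map suc (upTo n)} d∈)

    divisorList-unique : Unique (divisorList n)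
    divisorList-unique = UniqueP.filter⁺ (_∣? n) (UniqueP.map⁺ suc-injective (UniqueP.upTo⁺ n))

  divisorsPrimeTo : ℕ → ℕ → List ℕ
  divisorsPrimeTo p n = filter (∁? (p ∣?_)) (divisorList n)

  module _ {p n : ℕ} where

    ∈-divisorsPrimeTo⁺ : ∀ {d} .{{_ : NonZero n}} → d ∣ n → ¬ p ∣ d → d ∈ divisorsPrimeTo p n
    ∈-divisorsPrimeTo⁺ d∣n p∤d = ∈-filter⁺ (∁? (p ∣?_)) (∈-divisorList⁺ d∣n) p∤d

    ∈-divisorsPrimeTo⁻ : ∀ {d} → d ∈ divisorsPrimeTo p n → d ∣ n × ¬ p ∣ d
    ∈-divisorsPrimeTo⁻ d∈ with ∈-filter⁻ (∁? (p ∣?_)) {xs = divisorList n} d∈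
    ... | d∈divs , p∤d = ∈-divisorList⁻ d∈divs , p∤d

    divisorsPrimeTo-unique : Unique (divisorsPrimeTo p n)
    divisorsPrimeTo-unique = UniqueP.filter⁺ (∁? (p ∣?_)) (divisorList-unique {n})

    τ-lower-bound : ∀ {k} .{{_ : NonZero n}} → Prime p → p ^ k ∣ n →
                    suc k * length (divisorsPrimeTo p n) ≤ τ n
    τ-lower-bound {k} pr p^k∣n = begin
      suc k * length E                    ≡⟨ cong (_* length E) (length-upTo (suc k)) ⟨
      length (upTo (suc k)) * length E    ≡⟨ length-cartesianProduct (upTo (suc k)) E ⟨
      length pairs                        ≡⟨ length-map f pairs ⟨
      length (map f pairs)                ≤⟨ Unique⇒length≤ !f[pairs] f[pairs]⊆divisors ⟩
      τ n                                 ∎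
      where
      open ≤-Reasoning
      instance
        p-nonZero : NonZero p
        p-nonZero = prime⇒nonZero pr
      E : List ℕ
      E = divisorsPrimeTo p n
      pairs : List (ℕ × ℕ)
      pairs = cartesianProduct (upTo (suc k)) E
      f : ℕ × ℕ → ℕ
      f (j , e) = p ^ j * e
      !pairs : Unique pairs
      !pairs = UniqueP.cartesianProduct⁺ (UniqueP.upTo⁺ (suc k)) divisorsPrimeTo-unique
      f-injective : ∀ {x y} → x ∈ pairs → y ∈ pairs → f x ≡ f y → x ≡ y
      f-injective {i , d} {j , e} x∈ y∈ eq
        with proj₂ (∈-divisorsPrimeTo⁻ (proj₂ (∈-cartesianProduct⁻ (upTo (suc k)) E x∈)))
           | proj₂ (∈-divisorsPrimeTo⁻ (proj₂ (∈-cartesianProduct⁻ (upTo (suc k)) E y∈)))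
      ... | p∤d | p∤e = uncurry (cong₂ _,_) (p^i*m≡p^j*n⇒i≡j∧m≡n {i = i} {j} p∤d p∤e eq)
      !f[pairs] : Unique (map f pairs)
      !f[pairs] = Unique-map⁺-on f-injective !pairs
      f[pairs]⊆divisors : map f pairs ⊆ divisorList n
      f[pairs]⊆divisors v∈ with ∈-map⁻ f v∈
      ... | (j , e) , je∈ , refl with ∈-cartesianProduct⁻ (upTo (suc k)) E je∈
      ... | j∈ , e∈ with ∈-divisorsPrimeTo⁻ e∈
      ... | e∣n , p∤e = ∈-divisorList⁺ (coprime⇒*∣ (coprime-^ˡ j (prime∤⇒coprime pr p∤e))
                          (∣-trans (^-monoʳ-∣ p (≤-pred (∈-upTo⁻ j∈))) p^k∣n) e∣n)

  matching⇒nonZero : ∀ {n} → CoprimeMatching n → NonZero n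
  matching⇒nonZero {zero}  matching with CoprimeMatching.onto matching 1 z<s (1∣ 0)
  ... | () , _
  matching⇒nonZero {suc n} _ = _

  matchable⇒length-divisorsPrimeTo<p : ∀ {n p} → CoprimeMatching n → Prime p → p ^ p ∣ n →
                                       length (divisorsPrimeTo p n) < p
  matchable⇒length-divisorsPrimeTo<p {n} {p} matching pr p^p∣n = ≰⇒> p≰t
    where
    open CoprimeMatching matching
    instance
      n-nonZero : NonZero n
      n-nonZero = matching⇒nonZero matching
      p-nonZero : NonZero p
      p-nonZero = prime⇒nonZero pr
    E : List ℕ
    E = divisorsPrimeTo p n
    t : ℕ
    t = length E
    p≰t : ¬ p ≤ t
    p≰t p≤t = <-irrefl refl (begin-strict
      t                          <⟨ n<1+n t ⟩
      suc t                      ≡⟨ trans (length-map (ψ ∘ index) (allFin (suc t))) (length-tabulate id) ⟨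
      length (map (ψ ∘ index) (allFin (suc t)))
                                 ≤⟨ Unique⇒length≤ !ψ∘index ψ∘index∈E ⟩
      t                          ∎)
      where
      open ≤-Reasoning
      [1+t]*p≤τ : suc t * p ≤ τ n
      [1+t]*p≤τ = begin
        p + t * p     ≤⟨ +-monoˡ-≤ (t * p) p≤t ⟩
        t + t * p     ≡⟨ cong (t +_) (*-comm t p) ⟩
        suc p * t     ≤⟨ τ-lower-bound {k = p} pr p^p∣n ⟩
        τ n           ∎
      index : Fin (suc t) → Fin (τ n)
      index j = fromℕ< {pred p + toℕ j * p} (≤-trans (≤-reflexive (cong (_+ toℕ j * p) (suc-pred p)))
                                                (≤-trans (*-monoˡ-≤ p (toℕ<n j)) [1+t]*p≤τ))
      1+index≡[1+j]*p : ∀ j → suc (toℕ (index j)) ≡ suc (toℕ j) * p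
      1+index≡[1+j]*p j = trans (cong suc (toℕ-fromℕ< _)) (cong (_+ toℕ j * p) (suc-pred p))
      index-injective : ∀ {i j} → index i ≡ index j → i ≡ j
      index-injective {i} {j} eq = toℕ-injective (suc-injective (*-cancelʳ-≡ _ _ p (begin-equality
        suc (toℕ i) * p          ≡⟨ 1+index≡[1+j]*p i ⟨
        suc (toℕ (index i))      ≡⟨ cong (suc ∘ toℕ) eq ⟩
        suc (toℕ (index j))      ≡⟨ 1+index≡[1+j]*p j ⟩
        suc (toℕ j) * p          ∎)))
      !ψ∘index : Unique (map (ψ ∘ index) (allFin (suc t)))
      !ψ∘index = UniqueP.map⁺ (index-injective ∘ injective) (UniqueP.allFin⁺ (suc t))
      ψ∘index∈E : map (ψ ∘ index) (allFin (suc t)) ⊆ E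
      ψ∘index∈E v∈ with ∈-map⁻ (ψ ∘ index) {xs = allFin (suc t)} v∈
      ... | j , _ , refl = ∈-divisorsPrimeTo⁺ {p} {n} (into (index j))
        (prime∣coprime⇒∤ pr (coprime (index j)) (subst (p ∣_) (sym (1+index≡[1+j]*p j)) (n∣m*n (suc (toℕ j)))))

  -- A tower of pairwise coprime sparse moduli

  -- C i is K! times all earlier moduli and L i is coprime to C i, so the L i are pairwise
  -- coprime and coprime to K!.
  module Tower (K w : ℕ) where

    C : ℕ → ℕ
    L : ℕ → ℕ
    C zero    = K !
    C (suc i) = C i * L i
    L i = sparseModulus (C i) (4 * w * C i)

    L-nonZero : ∀ i → NonZero (L i)
    L-nonZero i = sparseModulus-nonZero (C i) (4 * w * C i)

    C-nonZero : ∀ i → NonZero (C i)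
    C-nonZero zero    = K !≢0
    C-nonZero (suc i) = m*n≢0 (C i) (L i) {{C-nonZero i}} {{L-nonZero i}}

    K!∣C : ∀ i → K ! ∣ C i
    K!∣C zero    = ∣-refl
    K!∣C (suc i) = ∣-trans (K!∣C i) (m∣m*n (L i))

    L∣C : ∀ {i j} → i < j → L i ∣ C j
    L∣C {i} {suc j} i<1+j with m≤n⇒m<n∨m≡n (≤-pred i<1+j)
    ... | inj₁ i<j  = ∣-trans (L∣C i<j) (m∣m*n (L j))
    ... | inj₂ refl = n∣m*n (C i)

    L-coprime-C : ∀ i → Coprime (L i) (C i)
    L-coprime-C i = sparseModulus-coprime (C i) (4 * w * C i)

    L-coprime : ∀ {i j} → i < j → Coprime (L j) (L i)
    L-coprime {j = j} i<j = coprime-∣ʳ (L-coprime-C j) (L∣C i<j)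

    totient-L : ∀ i → 2 * w * totient (L i) ≤ L i
    totient-L i = *-cancelˡ-≤ (2 * C i) {{m*n≢0 2 (C i) {{_}} {{C-nonZero i}}}} (begin
      2 * C i * (2 * w * totient (L i))   ≡⟨ reorder (C i) w (totient (L i)) ⟩
      4 * w * C i * totient (L i)         ≤⟨ totient-sparseModulus (C i) (4 * w * C i) {{C-nonZero i}} ⟩
      2 * (C i * L i)                     ≡⟨ *-assoc 2 (C i) (L i) ⟨
      2 * C i * L i                       ∎)
      where
      open ≤-Reasoning
      reorder : ∀ c w φ → 2 * c * (2 * w * φ) ≡ 4 * w * c * φ
      reorder = solve-∀

    count-coprime-L : ∀ i N → 2 * w * count (λ x → coprime? x (L i)) N ≤ N + L i
    count-coprime-L i N = *-cancelˡ-≤ (L i) {{L-nonZero i}} (begin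
      L i * (2 * w * c)                    ≡⟨ x*[y*z]≡y*[x*z] (L i) (2 * w) c ⟩
      2 * w * (L i * c)                    ≤⟨ *-monoʳ-≤ (2 * w) periodic-bound ⟩
      2 * w * ((N + L i) * totient (L i))  ≡⟨ x*[y*z]≡y*[x*z] (2 * w) (N + L i) (totient (L i)) ⟩
      (N + L i) * (2 * w * totient (L i))  ≤⟨ *-monoʳ-≤ (N + L i) (totient-L i) ⟩
      (N + L i) * L i                      ≡⟨ *-comm (N + L i) (L i) ⟩
      L i * (N + L i)                      ∎)
      where
      open ≤-Reasoning
      c : ℕ
      c = count (λ x → coprime? x (L i)) N
      periodic-bound : L i * c ≤ (N + L i) * totient (L i)
      periodic-bound = count-period-≤ (λ x → coprime? x (L i)) {{L-nonZero i}} (coprimeTo-periodic (L i)) N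
      x*[y*z]≡y*[x*z] : ∀ x y z → x * (y * z) ≡ y * (x * z)
      x*[y*z]≡y*[x*z] = solve-∀

    module _ {n m : ℕ} (shares-factor : ∀ {i} → i < m → ¬ Coprime n (L i)) where

      commonFactors : List ℕ
      commonFactors = 1 ∷ applyUpTo (λ i → gcd n (L i)) m

      length-commonFactors : length commonFactors ≡ suc m
      length-commonFactors = cong suc (length-applyUpTo _ m)

      commonFactors-unique : Unique commonFactors
      commonFactors-unique =
        AllP.applyUpTo⁺₁ _ m (λ i<m 1≡g → shares-factor i<m (gcd≡1⇒coprime (sym 1≡g)))
        ∷ AllPairsP.applyUpTo⁺₁ _ m distinct
        where
        distinct : ∀ {i j} → i < j → j < m → gcd n (L i) ≢ gcd n (L j)
        distinct {i} {j} i<j j<m gᵢ≡gⱼ = shares-factor j<m (gcd≡1⇒coprime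
          (L-coprime i<j (gcd[m,n]∣n n (L j) , subst (_∣ L i) gᵢ≡gⱼ (gcd[m,n]∣n n (L i)))))

      commonFactors-divide : All (λ d → d ∣ n × Coprime d (K !)) commonFactors
      commonFactors-divide = (1∣ n , 1-coprimeTo (K !)) All.∷ AllP.applyUpTo⁺₂ _ m λ i →
        gcd[m,n]∣m n (L i) , coprime-∣ˡ (coprime-∣ʳ (L-coprime-C i) (K!∣C i)) (gcd[m,n]∣n n (L i))

    CoprimeToSome : Pred ℕ _
    CoprimeToSome x = ∃ λ i → i < suc K × Coprime x (L i)

    coprimeToSome? : Decidable CoprimeToSome
    coprimeToSome? = ∃<? (λ i x → coprime? x (L i)) (suc K)

    matchable⇒sieved⊎coprime : ∀ {n} → CoprimeMatching n → NoneDivide (primePowers K) n ⊎ CoprimeToSome n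
    matchable⇒sieved⊎coprime {n} matching with noneDivide? (primePowers K) n | coprimeToSome? n
    ... | yes sieved | _           = inj₁ sieved
    ... | no _       | yes coprime = inj₂ coprime
    ... | no ¬sieved | no ¬coprime with ¬noneDivide⇒∃∣ (primePowers K) ¬sieved
    ... | _ , r∈ , r∣n with ∈-map⁻ (λ p → p ^ p) r∈
    ... | p , p∈ , refl with ∈-filter⁻ prime? {xs = upTo (suc K)} p∈
    ... | p∈upTo , pr = ⊥-elim (<-irrefl refl (begin-strict
      length factors                     ≤⟨ Unique⇒length≤ (commonFactors-unique shares) factors⊆ ⟩
      length (divisorsPrimeTo p n)       <⟨ matchable⇒length-divisorsPrimeTo<p matching pr r∣n ⟩
      p                                  <⟨ ∈-upTo⁻ p∈upTo ⟩
      suc K                              ≤⟨ n≤1+n (suc K) ⟩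
      suc (suc K)                        ≡⟨ length-commonFactors shares ⟨
      length factors                     ∎))
      where
      open ≤-Reasoning
      instance
        n-nonZero : NonZero n
        n-nonZero = matching⇒nonZero matching
        p-nonZero : NonZero p
        p-nonZero = prime⇒nonZero pr
      shares : ∀ {i} → i < suc K → ¬ Coprime n (L i)
      shares i<1+K c = ¬coprime (_ , i<1+K , c)
      factors : List ℕ
      factors = commonFactors shares
      factors⊆ : factors ⊆ divisorsPrimeTo p n
      factors⊆ d∈ with All.lookup (commonFactors-divide shares) d∈
      ... | d∣n , d⊥K! = ∈-divisorsPrimeTo⁺ d∣n
        (prime∣coprime⇒∤ pr (Coprime-sym d⊥K!) (m≤n⇒m∣n! (≤-pred (∈-upTo⁻ p∈upTo))))

    length≤sieved+coprime : ∀ N {xs} → Unique xs → All (λ n → 1 ≤ n × n ≤ N × Matchable n) xs →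
      length xs ≤ count (noneDivide? (primePowers K)) N + ∑[ i < suc K ] count (λ x → coprime? x (L i)) N
    length≤sieved+coprime N {xs} !xs xs-matchable = begin
      length xs
        ≤⟨ length≤count good? N !xs xs-good ⟩
      count good? N
        ≤⟨ count-∪-≤ sieved? coprimeToSome? N ⟩
      count sieved? N + count coprimeToSome? N
        ≤⟨ +-monoʳ-≤ _ (count-∃<-≤ (λ i x → coprime? x (L i)) (suc K) N) ⟩
      count sieved? N + ∑[ i < suc K ] count (λ x → coprime? x (L i)) N
        ∎
      where
      open ≤-Reasoning
      sieved? : Decidable (NoneDivide (primePowers K))
      sieved? = noneDivide? (primePowers K)
      good? : Decidable (NoneDivide (primePowers K) ∪ CoprimeToSome)
      good? = sieved? ∪? coprimeToSome?
      xs-good : All (λ n → 1 ≤ n × n ≤ N × (NoneDivide (primePowers K) ∪ CoprimeToSome) n) xs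
      xs-good = All.map (λ (1≤n , n≤N , matching) → 1≤n , n≤N , matchable⇒sieved⊎coprime matching)
                        xs-matchable

    ∑-count-coprime-L : ∀ N →
      2 * w * ∑[ i < suc K ] count (λ x → coprime? x (L i)) N ≤ suc K * N + ∑[ i < suc K ] L i
    ∑-count-coprime-L N = begin
      2 * w * ∑[ i < suc K ] count (λ x → coprime? x (L i)) N
        ≡⟨ ∑-distribˡ-* (2 * w) _ (suc K) ⟨
      ∑[ i < suc K ] (2 * w * count (λ x → coprime? x (L i)) N)
        ≤⟨ ∑-mono-≤ (suc K) (λ {i} _ → count-coprime-L i N) ⟩
      ∑[ i < suc K ] (N + L i)
        ≡⟨ ∑-distrib-+ (suc K) ⟩
      ∑[ i < suc K ] N + ∑[ i < suc K ] L i
        ≡⟨ cong (_+ ∑[ i < suc K ] L i) (∑-const N (suc K)) ⟩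
      suc K * N + ∑[ i < suc K ] L i
        ∎
      where open ≤-Reasoning

  density-arithmetic : ∀ {k q M Φ B N c S len} .{{_ : NonZero k}} →
    len ≤ c + S → M * c ≤ (N + M) * Φ → 2 * (k * q) * S ≤ k * N + B → 2 * q * Φ + B ≤ N →
    M * q * len ≤ (Φ * q + M) * N
  density-arithmetic {k} {q} {M} {Φ} {B} {N} {c} {S} {len} len≤ Mc≤ kqS≤ N₀≤N = *-cancelˡ-≤ 2 (begin
    2 * (M * q * len)                        ≤⟨ *-monoʳ-≤ 2 (*-monoʳ-≤ (M * q) len≤) ⟩
    2 * (M * q * (c + S))                    ≡⟨ expand M q c S ⟩
    2 * q * (M * c) + M * (2 * q * S)        ≤⟨ +-mono-≤ (*-monoʳ-≤ (2 * q) Mc≤) (*-monoʳ-≤ M 2qS≤N+B) ⟩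
    2 * q * ((N + M) * Φ) + M * (N + B)      ≡⟨ regroup q Φ M N B ⟩
    2 * q * Φ * N + M * (2 * q * Φ + B + N)  ≤⟨ +-monoʳ-≤ (2 * q * Φ * N) (*-monoʳ-≤ M (+-monoˡ-≤ N N₀≤N)) ⟩
    2 * q * Φ * N + M * (N + N)              ≡⟨ collect q Φ M N ⟩
    2 * ((Φ * q + M) * N)                    ∎)
    where
    open ≤-Reasoning
    expand : ∀ M q c S → 2 * (M * q * (c + S)) ≡ 2 * q * (M * c) + M * (2 * q * S)
    expand = solve-∀
    regroup : ∀ q Φ M N B → 2 * q * ((N + M) * Φ) + M * (N + B) ≡ 2 * q * Φ * N + M * (2 * q * Φ + B + N)
    regroup = solve-∀
    collect : ∀ q Φ M N → 2 * q * Φ * N + M * (N + N) ≡ 2 * ((Φ * q + M) * N)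
    collect = solve-∀
    2qS≤N+B : 2 * q * S ≤ N + B
    2qS≤N+B = *-cancelˡ-≤ k (begin
      k * (2 * q * S)       ≡⟨ reassoc k q S ⟩
      2 * (k * q) * S       ≤⟨ kqS≤ ⟩
      k * N + B             ≤⟨ +-monoʳ-≤ (k * N) (m≤n*m B k) ⟩
      k * N + k * B         ≡⟨ *-distribˡ-+ k N B ⟨
      k * (N + B)           ∎)
      where
      reassoc : ∀ k q S → k * (2 * q * S) ≡ 2 * (k * q) * S
      reassoc = solve-∀

open import Data.Rational using (ℚ; 0ℚ; _+_; _*_) renaming (_≤_ to _≤ℚ_; _<_ to _<ℚ_)
open import Data.Rational using (1ℚ; mkℚ; _/_; ↥_; ↧ₙ_; toℚᵘ; fromℚᵘ; Positive; positive)
open import Data.Rational.Properties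
  using ( toℚᵘ-injective; toℚᵘ-fromℚᵘ; toℚᵘ-homo-*; toℚᵘ-homo-+; toℚᵘ-cancel-≤; fromℚᵘ-cong
        ; ↥p/↧p≡p; normalize-nonNeg; normalize-pos; *-cancelˡ-≤-pos; +-monoʳ-≤
        ; *-monoˡ-≤-nonNeg; *-monoʳ-≤-nonNeg; *-identityˡ; *-identityʳ)
  renaming (module ≤-Reasoning to ℚ-≤-Reasoning)
open import Data.Rational.Unnormalised as ℚᵘ using (ℚᵘ; mkℚᵘ; *≡*; *≤*)
import Data.Rational.Unnormalised.Properties as ℚᵘ
open import Data.Rational.Solver using (module +-*-Solver)
import Data.Nat as ℕ
import Data.Nat.Properties as ℕ
import Data.Integer as ℤ
import Data.Integer.Properties as ℤ
open import Data.Integer using (+_; +≤+; +[1+_])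
open import Data.Nat.ListAction using (product)
open import Data.Nat.ListAction.Properties using (product≢0)
open import Data.Nat.Primality using (prime⇒nonZero)
open import Data.List using ([]; _∷_; map; foldr)
import Data.List.Relation.Unary.All as All
open import Data.Product using (_,_)
open import Relation.Binary.PropositionalEquality

fromℚᵘ-homo-* : ∀ p q → fromℚᵘ (p ℚᵘ.* q) ≡ fromℚᵘ p * fromℚᵘ q
fromℚᵘ-homo-* p q = toℚᵘ-injective (begin
  toℚᵘ (fromℚᵘ (p ℚᵘ.* q))                       ≈⟨ toℚᵘ-fromℚᵘ (p ℚᵘ.* q) ⟩
  p ℚᵘ.* q                                        ≈⟨ ℚᵘ.*-cong (toℚᵘ-fromℚᵘ p) (toℚᵘ-fromℚᵘ q) ⟨
  toℚᵘ (fromℚᵘ p) ℚᵘ.* toℚᵘ (fromℚᵘ q)           ≈⟨ toℚᵘ-homo-* (fromℚᵘ p) (fromℚᵘ q) ⟨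
  toℚᵘ (fromℚᵘ p * fromℚᵘ q)                      ∎)
  where open ℚᵘ.≃-Reasoning

fromℚᵘ-homo-+ : ∀ p q → fromℚᵘ (p ℚᵘ.+ q) ≡ fromℚᵘ p + fromℚᵘ q
fromℚᵘ-homo-+ p q = toℚᵘ-injective (begin
  toℚᵘ (fromℚᵘ (p ℚᵘ.+ q))                       ≈⟨ toℚᵘ-fromℚᵘ (p ℚᵘ.+ q) ⟩
  p ℚᵘ.+ q                                        ≈⟨ ℚᵘ.+-cong (toℚᵘ-fromℚᵘ p) (toℚᵘ-fromℚᵘ q) ⟨
  toℚᵘ (fromℚᵘ p) ℚᵘ.+ toℚᵘ (fromℚᵘ q)           ≈⟨ toℚᵘ-homo-+ (fromℚᵘ p) (fromℚᵘ q) ⟨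
  toℚᵘ (fromℚᵘ p + fromℚᵘ q)                      ∎)
  where open ℚᵘ.≃-Reasoning

ℕ→ℚ-homo-* : ∀ m n → ℕ→ℚ (m ℕ.* n) ≡ ℕ→ℚ m * ℕ→ℚ n
ℕ→ℚ-homo-* m n = trans (fromℚᵘ-cong m*n≃m*n) (fromℚᵘ-homo-* (mkℚᵘ (+ m) 0) (mkℚᵘ (+ n) 0))
  where
  m*n≃m*n : mkℚᵘ (+ (m ℕ.* n)) 0 ℚᵘ.≃ mkℚᵘ (+ m) 0 ℚᵘ.* mkℚᵘ (+ n) 0
  m*n≃m*n = *≡* (cong (ℤ._* + 1) (ℤ.pos-* m n))

ℕ→ℚ-homo-+ : ∀ m n → ℕ→ℚ (m ℕ.+ n) ≡ ℕ→ℚ m + ℕ→ℚ n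
ℕ→ℚ-homo-+ m n = trans (fromℚᵘ-cong m+n≃m+n) (fromℚᵘ-homo-+ (mkℚᵘ (+ m) 0) (mkℚᵘ (+ n) 0))
  where
  m+n≃m+n : mkℚᵘ (+ (m ℕ.+ n)) 0 ℚᵘ.≃ mkℚᵘ (+ m) 0 ℚᵘ.+ mkℚᵘ (+ n) 0
  m+n≃m+n = *≡* (cong (ℤ._* + 1)
    (trans (ℤ.pos-+ m n) (sym (cong₂ ℤ._+_ (ℤ.*-identityʳ (+ m)) (ℤ.*-identityʳ (+ n))))))

ℕ→ℚ-mono-≤ : ∀ {m n} → m ≤ n → ℕ→ℚ m ≤ℚ ℕ→ℚ n
ℕ→ℚ-mono-≤ {m} {n} m≤n = toℚᵘ-cancel-≤
  (ℚᵘ.≤-respˡ-≃ (ℚᵘ.≃-sym (toℚᵘ-fromℚᵘ (mkℚᵘ (+ m) 0)))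
  (ℚᵘ.≤-respʳ-≃ (ℚᵘ.≃-sym (toℚᵘ-fromℚᵘ (mkℚᵘ (+ n) 0)))
  (*≤* (ℤ.*-monoʳ-≤-nonNeg (+ 1) (+≤+ m≤n)))))

/-*-ℕ→ℚ : ∀ i d .{{_ : ℕ.NonZero d}} → (i / d) * ℕ→ℚ d ≡ i / 1
/-*-ℕ→ℚ i (ℕ.suc d) = trans (sym (fromℚᵘ-homo-* (mkℚᵘ i d) (mkℚᵘ (+ ℕ.suc d) 0))) (fromℚᵘ-cong cancel)
  where
  cancel : mkℚᵘ i d ℚᵘ.* mkℚᵘ (+ ℕ.suc d) 0 ℚᵘ.≃ mkℚᵘ i 0
  cancel = *≡* (trans (ℤ.*-identityʳ _) (cong (λ k → i ℤ.* + ℕ.suc k) (sym (ℕ.*-identityʳ d))))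

factor-* : ∀ p .{{_ : ℕ.NonZero p}} → factor p * ℕ→ℚ (p ℕ.^ p) ≡ ℕ→ℚ (p ℕ.^ p ℕ.∸ 1)
factor-* p@(ℕ.suc _) = /-*-ℕ→ℚ (+ (p ℕ.^ p ℕ.∸ 1)) (p ℕ.^ p) {{ℕ.m^n≢0 p p}}

∏factor-* : ∀ ps → All ℕ.NonZero ps →
            foldr (λ p acc → factor p * acc) 1ℚ ps * ℕ→ℚ (product (map (λ p → p ℕ.^ p) ps))
            ≡ ℕ→ℚ (product (map (ℕ._∸ 1) (map (λ p → p ℕ.^ p) ps)))
∏factor-* []       All.[]             = *-identityˡ 1ℚ
∏factor-* (p ∷ ps) (p≢0 All.∷ ps≢0) = begin
  (factor p * A) * ℕ→ℚ (p ℕ.^ p ℕ.* P)               ≡⟨ cong ((factor p * A) *_) (ℕ→ℚ-homo-* (p ℕ.^ p) P) ⟩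
  (factor p * A) * (ℕ→ℚ (p ℕ.^ p) * ℕ→ℚ P)           ≡⟨ interchange (factor p) A (ℕ→ℚ (p ℕ.^ p)) (ℕ→ℚ P) ⟩
  (factor p * ℕ→ℚ (p ℕ.^ p)) * (A * ℕ→ℚ P)           ≡⟨ cong₂ _*_ (factor-* p {{p≢0}}) (∏factor-* ps ps≢0) ⟩
  ℕ→ℚ (p ℕ.^ p ℕ.∸ 1) * ℕ→ℚ Φ                         ≡⟨ ℕ→ℚ-homo-* (p ℕ.^ p ℕ.∸ 1) Φ ⟨
  ℕ→ℚ ((p ℕ.^ p ℕ.∸ 1) ℕ.* Φ)                         ∎
  where
  open ≡-Reasoning
  A : ℚ
  A = foldr (λ p acc → factor p * acc) 1ℚ ps
  P Φ : ℕ
  P = product (map (λ p → p ℕ.^ p) ps)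
  Φ = product (map (ℕ._∸ 1) (map (λ p → p ℕ.^ p) ps))
  interchange : ∀ a b c d → (a * b) * (c * d) ≡ (a * c) * (b * d)
  interchange = +-*-Solver.solve 4 (λ a b c d → (a :* b) :* (c :* d) := (a :* c) :* (b :* d)) refl
    where open +-*-Solver

1≤ε*↧ε : ∀ ε → 0ℚ <ℚ ε → 1ℚ ≤ℚ ε * ℕ→ℚ (↧ₙ ε)
1≤ε*↧ε ε 0<ε = positive-case ε {{positive 0<ε}}
  where
  positive-case : ∀ ε .{{_ : Positive ε}} → 1ℚ ≤ℚ ε * ℕ→ℚ (↧ₙ ε)
  positive-case ε@(mkℚ +[1+ a ] _ _) = subst (1ℚ ≤ℚ_)
    (sym (trans (cong (_* ℕ→ℚ (↧ₙ ε)) (sym (↥p/↧p≡p ε))) (/-*-ℕ→ℚ (↥ ε) (↧ₙ ε))))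
    (ℕ→ℚ-mono-≤ {1} {ℕ.suc a} (ℕ.s≤s ℕ.z≤n))

density-ℚ : ∀ α ε M Φ q len N .{{_ : ℕ.NonZero M}} .{{_ : ℕ.NonZero q}} →
            α * ℕ→ℚ M ≡ ℕ→ℚ Φ → 1ℚ ≤ℚ ε * ℕ→ℚ q →
            M ℕ.* q ℕ.* len ≤ (Φ ℕ.* q ℕ.+ M) ℕ.* N → ℕ→ℚ len ≤ℚ (α + ε) * ℕ→ℚ N
density-ℚ α ε M Φ q len N αM≡Φ 1≤εq bound =
  *-cancelˡ-≤-pos (ℕ→ℚ (M ℕ.* q)) {{normalize-pos (M ℕ.* q) 1 {{_}} {{ℕ.m*n≢0 M q}}}} (begin
    ℕ→ℚ (M ℕ.* q) * ℕ→ℚ len                       ≡⟨ ℕ→ℚ-homo-* (M ℕ.* q) len ⟨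
    ℕ→ℚ (M ℕ.* q ℕ.* len)                          ≤⟨ ℕ→ℚ-mono-≤ bound ⟩
    ℕ→ℚ ((Φ ℕ.* q ℕ.+ M) ℕ.* N)                    ≡⟨ cast ⟩
    (ℕ→ℚ Φ * q′ + M′) * N′                         ≡⟨ cong (λ x → (x * q′ + M′) * N′) αM≡Φ ⟨
    (α * M′ * q′ + M′) * N′                        ≡⟨ cong (λ x → (α * M′ * q′ + x) * N′) (*-identityʳ M′) ⟨
    (α * M′ * q′ + M′ * 1ℚ) * N′                   ≤⟨ *-monoʳ-≤-nonNeg N′ {{normalize-nonNeg N 1}}
                                                        (+-monoʳ-≤ (α * M′ * q′) M′≤M′εq′) ⟩
    (α * M′ * q′ + M′ * (ε * q′)) * N′             ≡⟨ regroup α ε M′ q′ N′ ⟩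
    M′ * q′ * ((α + ε) * N′)                       ≡⟨ cong (_* ((α + ε) * N′)) (ℕ→ℚ-homo-* M q) ⟨
    ℕ→ℚ (M ℕ.* q) * ((α + ε) * N′)                 ∎)
  where
  open ℚ-≤-Reasoning
  M′ q′ N′ : ℚ
  M′ = ℕ→ℚ M
  q′ = ℕ→ℚ q
  N′ = ℕ→ℚ N
  M′≤M′εq′ : M′ * 1ℚ ≤ℚ M′ * (ε * q′)
  M′≤M′εq′ = *-monoˡ-≤-nonNeg M′ {{normalize-nonNeg M 1}} 1≤εq
  cast : ℕ→ℚ ((Φ ℕ.* q ℕ.+ M) ℕ.* N) ≡ (ℕ→ℚ Φ * q′ + M′) * N′
  cast = trans (ℕ→ℚ-homo-* (Φ ℕ.* q ℕ.+ M) N)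
               (cong (_* N′) (trans (ℕ→ℚ-homo-+ (Φ ℕ.* q) M) (cong (_+ M′) (ℕ→ℚ-homo-* Φ q))))
  regroup : ∀ α ε m q n → (α * m * q + m * (ε * q)) * n ≡ m * q * ((α + ε) * n)
  regroup = +-*-Solver.solve 5
    (λ α ε m q n → (α :* m :* q :+ m :* (ε :* q)) :* n := m :* q :* ((α :+ ε) :* n)) refl
    where open +-*-Solver

partialα-* : ∀ K → partialα K * ℕ→ℚ (product (primePowers K))
                   ≡ ℕ→ℚ (product (map (ℕ._∸ 1) (primePowers K)))
partialα-* K = ∏factor-* (primesUpTo K) (All.map prime⇒nonZero (primesUpTo-prime K))

corollary2p3 : (K : ℕ) (ε : ℚ) → 0ℚ <ℚ ε →
    Σ ℕ λ N₀ → (N : ℕ) → N₀ ≤ N →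
      (xs : List ℕ) → Unique xs → All (λ n → 1 ≤ n × n ≤ N × Matchable n) xs →
      ℕ→ℚ (length xs) ≤ℚ (partialα K + ε) * ℕ→ℚ N
corollary2p3 K ε 0<ε = N₀ , bound
  where
  q : ℕ
  q = ↧ₙ ε
  open Tower K (ℕ.suc K ℕ.* q)
  M Φ N₀ : ℕ
  M = product (primePowers K)
  Φ = product (map (ℕ._∸ 1) (primePowers K))
  N₀ = 2 ℕ.* q ℕ.* Φ ℕ.+ ∑[ i < ℕ.suc K ] L i
  bound : (N : ℕ) → N₀ ≤ N → (xs : List ℕ) → Unique xs → All (λ n → 1 ≤ n × n ≤ N × Matchable n) xs →
          ℕ→ℚ (length xs) ≤ℚ (partialα K + ε) * ℕ→ℚ N
  bound N N₀≤N xs !xs xs-matchable =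
    density-ℚ (partialα K) ε M Φ q (length xs) N {{product≢0 (primePowers-nonZero K)}}
      (partialα-* K) (1≤ε*↧ε ε 0<ε)
      (density-arithmetic {k = ℕ.suc K}
        (length≤sieved+coprime N !xs xs-matchable) (count-sieved K N) (∑-count-coprime-L N) N₀≤N)
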